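{- Let $B\in\mathbb{Z}^{r\times r}$ be unimodular. Then there exist a positive integer $s$ (depending only on $B$) and integer matrices $S,T$ with $r$ columns such that the $s\times r$ matrix $$\overline B=\begin{pmatrix}I_r\\ S\\ B\\ T\\ I_r\end{pmatrix}$$ has the property that for each $i\in[1,s-(r-1)]$, the $r\times r$ submatrix formed by rows $i,i+1,\dots,i+r-1$ of $\overline B$ is unimodular.
   Context: Unimodular means an integer square matrix with determinant $\pm1$. $I_r$ is the $r\times r$ identity matrix. -}

module Defs where

open import Data.Nat as ℕ using (ℕ; zero; suc; _≤_; _<_)
open import Data.Nat.Properties using (+-monoʳ-<; ≤-trans)
open import Relation.Nullary using (yes; no)
open import Data.Integer as ℤ using (ℤ; +_; -[1+_])
open import Data.Fin as Fin using (Fin; toℕ; fromℕ<; punchIn)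
open import Data.Fin.Properties using (toℕ<n)
open import Data.Sum using (_⊎_)
open import Relation.Binary.PropositionalEquality using (_≡_)
import Data.Vec.Functional as VF

Matrix : ℕ → ℕ → Set
Matrix m n = Fin m → Fin n → ℤ

∑ : ∀ {n} → (Fin n → ℤ) → ℤ
∑ {zero}  f = + 0
∑ {suc n} f = f Fin.zero ℤ.+ ∑ (λ j → f (Fin.suc j))

sign : ℕ → ℤ
sign zero          = + 1
sign (suc zero)    = -[1+ 0 ]
sign (suc (suc k)) = sign k

det : ∀ {n} → Matrix n n → ℤ
det {zero}  M = + 1
det {suc n} M =
  ∑ (λ (j : Fin (suc n)) →
       sign (toℕ j) ℤ.* (M Fin.zero j ℤ.* det (λ a b → M (Fin.suc a) (punchIn j b))))

Unimodular : ∀ {n} → Matrix n n → Set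
Unimodular M = det M ≡ + 1 ⊎ det M ≡ -[1+ 0 ]

I : ∀ r → Matrix r r
I r a b with a Fin.≟ b
... | yes _ = + 1
... | no  _ = + 0

infixr 5 _⊘_
_⊘_ : ∀ {m n r} → Matrix m r → Matrix n r → Matrix (m ℕ.+ n) r
A ⊘ B = A VF.++ B

-- The r × r submatrix of M formed by rows i, i+1, …, i+r-1 (0-indexed i),
-- given that these rows exist (i + r ≤ s).
window : ∀ {s r} → Matrix s r → (i : ℕ) → i ℕ.+ r ≤ s → Matrix r r
window {s} {r} M i h k l =
  M (fromℕ< {i ℕ.+ toℕ k} (≤-trans (+-monoʳ-< i (toℕ<n k)) h)) l

-- Integer row additions (the Euclidean algorithm on the first column, then induction on the
-- size) lead from B to the identity through matrices W₀ = B, W₁, …, Wₖ = I of determinant ±1,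
-- each obtained from the previous one by changing a single row. Stack the walk from I back to B
-- and then the walk from B to I. Any r consecutive rows of the stack lie within two consecutive
-- blocks Wⱼ, Wⱼ₊₁; since these agree outside one row, the r rows are a cyclic rotation of the
-- rows of Wⱼ or of Wⱼ₊₁, and rotating the rows changes the determinant only by a sign.
module Submission where

open import Defs

module RowReduction where

  open import Data.Nat as ℕ using (ℕ; zero; suc; _≤_; _<_; s≤s; z≤n; _∸_)
  import Data.Nat.Properties as ℕ
  open import Data.Integer as ℤ using (ℤ; +_; -[1+_]; _+_; _*_; -_; ∣_∣)
  open import Data.Integer.Properties
    using ( +-*-semiring; *-commutativeSemigroup; +-identityˡ; +-identityʳ; *-identityˡ; *-identityʳ; *-zeroʳ
          ; *-assoc; *-comm; *-distribʳ-+; neg-involutive; neg-distrib-+; neg-distribˡ-*; neg-distribʳ-*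
          ; -1*i≡-i; abs-*; ∣i∣≡0⇒i≡0 )
  open import Data.Integer.DivMod using (a≡a%n+[a/n]*n; n%d<d)
  open import Data.Integer.Tactic.RingSolver using (solve-∀)
  open import Data.Fin as Fin using (Fin; toℕ; punchIn; punchOut; fromℕ<)
  open import Data.Fin.Properties using (punchInᵢ≢i; toℕ-injective; toℕ-fromℕ<)
  open import Data.List as List using (List; []; _∷_; [_]; map; length; tabulate; _++_; take; drop)
  import Data.List.Properties as List
  open import Data.List.Relation.Binary.Pointwise as Pointwise using (Pointwise; []; _∷_)
  import Data.Vec.Functional as Vector
  open import Data.Empty using (⊥-elim)
  open import Data.Sum using (_⊎_; inj₁; inj₂)
  open import Data.Product using (_×_; _,_; proj₁; proj₂; ∃-syntax)
  open import Function using (_∘_)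
  open import Relation.Nullary using (yes; no)
  open import Relation.Binary.PropositionalEquality hiding ([_])
  open import Relation.Binary.Construct.Closure.ReflexiveTransitive using (Star; ε; _◅_; _◅◅_; gmap; reverse)
  import Algebra.Properties.Semiring.Sum
  open import Algebra.Properties.CommutativeSemigroup *-commutativeSemigroup using (x∙yz≈y∙xz)
  open ≡-Reasoning

  Row : ℕ → Set
  Row n = Fin n → ℤ

  module Summation = Algebra.Properties.Semiring.Sum +-*-semiring

  ∑≡sum : ∀ {n} (f : Fin n → ℤ) → ∑ f ≡ Summation.sum f
  ∑≡sum {zero}  f = refl
  ∑≡sum {suc n} f = cong (_+_ (f Fin.zero)) (∑≡sum (f ∘ Fin.suc))

  ∑-cong : ∀ {n} {f g : Fin n → ℤ} → f ≗ g → ∑ f ≡ ∑ g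
  ∑-cong {f = f} {g} f≗g = trans (∑≡sum f) (trans (Summation.sum-cong-≗ f≗g) (sym (∑≡sum g)))

  ∑-zero : ∀ {n} (f : Fin n → ℤ) → (∀ j → f j ≡ + 0) → ∑ f ≡ + 0
  ∑-zero {zero}  f f≗0 = refl
  ∑-zero {suc n} f f≗0 = cong₂ _+_ (f≗0 Fin.zero) (∑-zero (f ∘ Fin.suc) (f≗0 ∘ Fin.suc))

  ∑-distrib-+ : ∀ {n} (f g : Fin n → ℤ) → ∑ (λ j → f j + g j) ≡ ∑ f + ∑ g
  ∑-distrib-+ f g = begin
    ∑ (λ j → f j + g j)               ≡⟨ ∑≡sum (λ j → f j + g j) ⟩
    Summation.sum (λ j → f j + g j)   ≡⟨ Summation.∑-distrib-+ f g ⟩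
    Summation.sum f + Summation.sum g ≡⟨ cong₂ _+_ (∑≡sum f) (∑≡sum g) ⟨
    ∑ f + ∑ g                         ∎

  *-distribˡ-∑ : ∀ {n} (a : ℤ) (f : Fin n → ℤ) → a * ∑ f ≡ ∑ (λ j → a * f j)
  *-distribˡ-∑ a f = begin
    a * ∑ f                       ≡⟨ cong (a *_) (∑≡sum f) ⟩
    a * Summation.sum f           ≡⟨ Summation.*-distribˡ-sum a f ⟩
    Summation.sum (λ j → a * f j) ≡⟨ ∑≡sum (λ j → a * f j) ⟨
    ∑ (λ j → a * f j)             ∎

  ∑-comm : ∀ {m n} (f : Fin m → Fin n → ℤ) → ∑ (λ i → ∑ (f i)) ≡ ∑ (λ j → ∑ (λ i → f i j))
  ∑-comm f = begin
    ∑ (λ i → ∑ (f i))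
      ≡⟨ trans (∑-cong (∑≡sum ∘ f)) (∑≡sum (λ i → Summation.sum (f i))) ⟩
    Summation.sum (λ i → Summation.sum (f i))
      ≡⟨ Summation.∑-comm f ⟩
    Summation.sum (λ j → Summation.sum (λ i → f i j))
      ≡⟨ trans (∑-cong (λ j → ∑≡sum (λ i → f i j))) (∑≡sum (λ j → Summation.sum (λ i → f i j))) ⟨
    ∑ (λ j → ∑ (λ i → f i j)) ∎

  *-distribˡ-∑₂ : ∀ {n} (s x : ℤ) (y f : Fin n → ℤ) → s * (x * ∑ (λ c → y c * f c)) ≡ ∑ (λ c → y c * (s * (x * f c)))
  *-distribˡ-∑₂ s x y f = begin
    s * (x * ∑ (λ c → y c * f c))     ≡⟨ cong (s *_) (*-distribˡ-∑ x (λ c → y c * f c)) ⟩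
    s * ∑ (λ c → x * (y c * f c))     ≡⟨ *-distribˡ-∑ s (λ c → x * (y c * f c)) ⟩
    ∑ (λ c → s * (x * (y c * f c)))   ≡⟨ ∑-cong (λ c → trans (cong (s *_) (x∙yz≈y∙xz x (y c) (f c)))
                                                            (x∙yz≈y∙xz s (y c) (x * f c))) ⟩
    ∑ (λ c → y c * (s * (x * f c)))   ∎

  ∑-neg : ∀ {n} (f : Fin n → ℤ) → ∑ (λ j → - f j) ≡ - ∑ f
  ∑-neg {zero}  f = refl
  ∑-neg {suc n} f = trans (cong (_+_ (- f Fin.zero)) (∑-neg (f ∘ Fin.suc)))
                          (sym (neg-distrib-+ (f Fin.zero) (∑ (f ∘ Fin.suc))))

  basis : ∀ {n} → Fin n → Row n
  basis Fin.zero    Fin.zero    = + 1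
  basis Fin.zero    (Fin.suc _) = + 0
  basis (Fin.suc _) Fin.zero    = + 0
  basis (Fin.suc k) (Fin.suc j) = basis k j

  ∑-basisˡ : ∀ {n} (k : Fin n) (f : Fin n → ℤ) → ∑ (λ j → basis k j * f j) ≡ f k
  ∑-basisˡ Fin.zero f =
    trans (cong₂ _+_ (*-identityˡ (f Fin.zero)) (∑-zero (λ j → basis Fin.zero (Fin.suc j) * f (Fin.suc j)) (λ _ → refl)))
          (+-identityʳ (f Fin.zero))
  ∑-basisˡ (Fin.suc k) f = trans (+-identityˡ _) (∑-basisˡ k (f ∘ Fin.suc))

  ∑-basisʳ : ∀ {n} (k : Fin n) (f : Fin n → ℤ) → ∑ (λ j → f j * basis j k) ≡ f k
  ∑-basisʳ Fin.zero f =
    trans (cong₂ _+_ (*-identityʳ (f Fin.zero)) (∑-zero (λ j → f (Fin.suc j) * + 0) (λ j → *-zeroʳ (f (Fin.suc j)))))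
          (+-identityʳ (f Fin.zero))
  ∑-basisʳ (Fin.suc k) f = trans (cong (_+ ∑ (λ j → f (Fin.suc j) * basis j k)) (*-zeroʳ (f Fin.zero)))
                                 (trans (+-identityˡ _) (∑-basisʳ k (f ∘ Fin.suc)))

  sign-suc : ∀ k → sign (suc k) ≡ - sign k
  sign-suc zero    = refl
  sign-suc (suc k) = trans (sym (neg-involutive (sign k))) (cong -_ (sym (sign-suc k)))

  -- Determinants of lists of rows

  infix 4 _≋_
  _≋_ : ∀ {n} → List (Row n) → List (Row n) → Set
  _≋_ = Pointwise _≗_

  ≋-refl : ∀ {n} {xs : List (Row n)} → xs ≋ xs
  ≋-refl = Pointwise.refl (λ _ → refl)

  ≋-sym : ∀ {n} {xs ys : List (Row n)} → xs ≋ ys → ys ≋ xs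
  ≋-sym = Pointwise.symmetric (sym ∘_)

  ≋-take : ∀ {n} i {xs ys : List (Row n)} → xs ≋ ys → take i xs ≋ take i ys
  ≋-take zero    _             = []
  ≋-take (suc i) []            = []
  ≋-take (suc i) (x≗y ∷ xs≋ys) = x≗y ∷ ≋-take i xs≋ys

  ≋-drop : ∀ {n} i {xs ys : List (Row n)} → xs ≋ ys → drop i xs ≋ drop i ys
  ≋-drop zero    xs≋ys       = xs≋ys
  ≋-drop (suc i) []          = []
  ≋-drop (suc i) (_ ∷ xs≋ys) = ≋-drop i xs≋ys

  dropColumn : ∀ {n} → Fin (suc n) → List (Row (suc n)) → List (Row n)
  dropColumn j = map (_∘ punchIn j)

  -- Laplace expansion along the first row, as in det; the value is 0 unless there are exactly n rows.
  detRows : ∀ {n} → List (Row n) → ℤ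
  detRows {zero}  []       = + 1
  detRows {zero}  (_ ∷ _)  = + 0
  detRows {suc n} []       = + 0
  detRows {suc n} (x ∷ xs) = ∑ λ j → sign (toℕ j) * (x j * detRows (dropColumn j xs))

  det≡detRows : ∀ {n} (M : Matrix n n) → det M ≡ detRows (tabulate M)
  det≡detRows {zero}  M = refl
  det≡detRows {suc n} M = ∑-cong λ j → cong (λ d → sign (toℕ j) * (M Fin.zero j * d)) (det-minor j)
    where
    det-minor : ∀ j → det (λ a b → M (Fin.suc a) (punchIn j b)) ≡ detRows (dropColumn j (tabulate (M ∘ Fin.suc)))
    det-minor j = trans (det≡detRows (λ a b → M (Fin.suc a) (punchIn j b)))
                        (cong detRows (sym (List.map-tabulate (M ∘ Fin.suc) (_∘ punchIn j))))

  dropColumn-cong : ∀ {n} (j : Fin (suc n)) {xs ys} → xs ≋ ys → dropColumn j xs ≋ dropColumn j ys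
  dropColumn-cong j = Pointwise.map⁺ _ _ ∘ Pointwise.map (λ x≗y → x≗y ∘ punchIn j)

  detRows-cong : ∀ {n} {xs ys : List (Row n)} → xs ≋ ys → detRows xs ≡ detRows ys
  detRows-cong {zero}  []            = refl
  detRows-cong {zero}  (_ ∷ _)       = refl
  detRows-cong {suc n} []            = refl
  detRows-cong {suc n} (x≗y ∷ xs≋ys) = ∑-cong λ j →
    cong₂ (λ a d → sign (toℕ j) * (a * d)) (x≗y j) (detRows-cong (dropColumn-cong j xs≋ys))

  infixl 6 _[_]≔_
  _[_]≔_ : ∀ {A : Set} → List A → ℕ → A → List A
  []       [ _     ]≔ _ = []
  (x ∷ xs) [ zero  ]≔ y = y ∷ xs
  (x ∷ xs) [ suc i ]≔ y = x ∷ xs [ i ]≔ y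

  row : ∀ {n} → List (Row n) → ℕ → Row n
  row []       _       = λ _ → + 0
  row (x ∷ _)  zero    = x
  row (_ ∷ xs) (suc k) = row xs k

  length-≔ : ∀ {A : Set} (xs : List A) i y → length (xs [ i ]≔ y) ≡ length xs
  length-≔ []       _       _ = refl
  length-≔ (x ∷ xs) zero    _ = refl
  length-≔ (x ∷ xs) (suc i) y = cong suc (length-≔ xs i y)

  dropColumn-≔ : ∀ {n} (j : Fin (suc n)) xs i (y : Row (suc n)) →
                 dropColumn j (xs [ i ]≔ y) ≡ dropColumn j xs [ i ]≔ (y ∘ punchIn j)
  dropColumn-≔ j []       _       _ = refl
  dropColumn-≔ j (x ∷ xs) zero    _ = refl
  dropColumn-≔ j (x ∷ xs) (suc i) y = cong (x ∘ punchIn j ∷_) (dropColumn-≔ j xs i y)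

  length-dropColumn : ∀ {n} (j : Fin (suc n)) xs → length (dropColumn j xs) ≡ length xs
  length-dropColumn j = List.length-map (_∘ punchIn j)

  <-length-dropColumn : ∀ {n} (j : Fin (suc n)) xs {i} → i < length xs → i < length (dropColumn j xs)
  <-length-dropColumn j xs = subst (_ <_) (sym (length-dropColumn j xs))

  row-dropColumn : ∀ {n} (j : Fin (suc n)) xs k → row (dropColumn j xs) k ≡ row xs k ∘ punchIn j
  row-dropColumn j []       _       = refl
  row-dropColumn j (x ∷ xs) zero    = refl
  row-dropColumn j (x ∷ xs) (suc k) = row-dropColumn j xs k

  row-≔-same : ∀ {n} (xs : List (Row n)) i y → i < length xs → row (xs [ i ]≔ y) i ≡ y
  row-≔-same (x ∷ xs) zero    y _         = refl
  row-≔-same (x ∷ xs) (suc i) y (s≤s i<) = row-≔-same xs i y i<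

  row-≔-other : ∀ {n} (xs : List (Row n)) {i k} y → i ≢ k → row (xs [ i ]≔ y) k ≡ row xs k
  row-≔-other []       {_}     {_}     _ _   = refl
  row-≔-other (x ∷ xs) {zero}  {zero}  _ i≢k = ⊥-elim (i≢k refl)
  row-≔-other (x ∷ xs) {zero}  {suc k} _ _   = refl
  row-≔-other (x ∷ xs) {suc i} {zero}  _ _   = refl
  row-≔-other (x ∷ xs) {suc i} {suc k} y i≢k = row-≔-other xs y (i≢k ∘ cong suc)

  ≔-row : ∀ {n} (xs : List (Row n)) i → xs [ i ]≔ row xs i ≡ xs
  ≔-row []       _       = refl
  ≔-row (x ∷ xs) zero    = refl
  ≔-row (x ∷ xs) (suc i) = cong (x ∷_) (≔-row xs i)

  detRows-basis-head : ∀ {n} (c : Fin (suc n)) xs →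
                       detRows (basis c ∷ xs) ≡ sign (toℕ c) * detRows (dropColumn c xs)
  detRows-basis-head c xs =
    trans (∑-cong λ j → x∙yz≈y∙xz (sign (toℕ j)) (basis c j) (detRows (dropColumn j xs)))
          (∑-basisˡ c λ j → sign (toℕ j) * detRows (dropColumn j xs))

  ∑-basis-reindex : ∀ {m k} (y : Fin k → ℤ) (h : Fin m → Fin k) (g : Fin m → ℤ) →
                    ∑ (λ c → y c * ∑ (λ l → basis c (h l) * g l)) ≡ ∑ (λ l → y (h l) * g l)
  ∑-basis-reindex y h g = begin
    ∑ (λ c → y c * ∑ (λ l → basis c (h l) * g l))   ≡⟨ ∑-cong (λ c → *-distribˡ-∑ (y c) (λ l → basis c (h l) * g l)) ⟩
    ∑ (λ c → ∑ (λ l → y c * (basis c (h l) * g l))) ≡⟨ ∑-comm (λ c l → y c * (basis c (h l) * g l)) ⟩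
    ∑ (λ l → ∑ (λ c → y c * (basis c (h l) * g l))) ≡⟨ ∑-cong (λ l → ∑-cong (λ c → sym (*-assoc (y c) _ (g l)))) ⟩
    ∑ (λ l → ∑ (λ c → y c * basis c (h l) * g l))   ≡⟨ ∑-cong (λ l → trans (∑-cong (λ c → *-comm (y c * basis c (h l)) (g l)))
                                                         (sym (*-distribˡ-∑ (g l) (λ c → y c * basis c (h l))))) ⟩
    ∑ (λ l → g l * ∑ (λ c → y c * basis c (h l)))   ≡⟨ ∑-cong (λ l → trans (cong (g l *_) (∑-basisʳ (h l) y))
                                                         (*-comm (g l) (y (h l)))) ⟩
    ∑ (λ l → y (h l) * g l)                          ∎

  detRows-expand : ∀ {n} (W : List (Row n)) i (y : Row n) → i < length W →
                   detRows (W [ i ]≔ y) ≡ ∑ λ c → y c * detRows (W [ i ]≔ basis c)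
  detRows-expand {zero}  (x ∷ xs) zero    y _ = refl
  detRows-expand {zero}  (x ∷ xs) (suc i) y _ = refl
  detRows-expand {suc n} (x ∷ xs) zero    y _ = sym (begin
    ∑ (λ c → y c * detRows (basis c ∷ xs))
      ≡⟨ ∑-cong (λ c → cong (y c *_) (detRows-basis-head c xs)) ⟩
    ∑ (λ c → y c * (sign (toℕ c) * detRows (dropColumn c xs)))
      ≡⟨ ∑-cong (λ c → x∙yz≈y∙xz (y c) (sign (toℕ c)) (detRows (dropColumn c xs))) ⟩
    detRows (y ∷ xs) ∎)
  detRows-expand {suc n} (x ∷ xs) (suc i) y (s≤s i<) = begin
    detRows (x ∷ xs [ i ]≔ y)
      ≡⟨ ∑-cong (λ j → cong (term j) (minor-expand j y)) ⟩
    ∑ (λ j → term j (∑ λ l → y (punchIn j l) * E j l))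
      ≡⟨ ∑-cong (λ j → cong (term j) (sym (∑-basis-reindex y (punchIn j) (E j)))) ⟩
    ∑ (λ j → term j (∑ λ c → y c * F c j))
      ≡⟨ ∑-cong (λ j → *-distribˡ-∑₂ (sign (toℕ j)) (x j) y (λ c → F c j)) ⟩
    ∑ (λ j → ∑ λ c → y c * term j (F c j))
      ≡⟨ ∑-comm (λ j c → y c * term j (F c j)) ⟩
    ∑ (λ c → ∑ λ j → y c * term j (F c j))
      ≡⟨ ∑-cong (λ c → sym (*-distribˡ-∑ (y c) (λ j → term j (F c j)))) ⟩
    ∑ (λ c → y c * ∑ λ j → term j (F c j))
      ≡⟨ ∑-cong (λ c → cong (y c *_) (∑-cong λ j → cong (term j) (sym (minor-expand j (basis c))))) ⟩
    ∑ (λ c → y c * detRows (x ∷ xs [ i ]≔ basis c)) ∎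
    where
    term : Fin (suc n) → ℤ → ℤ
    term j d = sign (toℕ j) * (x j * d)
    E : Fin (suc n) → Fin n → ℤ
    E j l = detRows (dropColumn j xs [ i ]≔ basis l)
    F : Fin (suc n) → Fin (suc n) → ℤ
    F c j = ∑ λ l → basis c (punchIn j l) * E j l
    minor-expand : ∀ j (z : Row (suc n)) → detRows (dropColumn j (xs [ i ]≔ z)) ≡ ∑ λ l → z (punchIn j l) * E j l
    minor-expand j z = trans (cong detRows (dropColumn-≔ j xs i z))
      (detRows-expand (dropColumn j xs) i (z ∘ punchIn j) (<-length-dropColumn j xs i<))

  detRows-linear : ∀ {n} (W : List (Row n)) i a (x y : Row n) → i < length W →
                   detRows (W [ i ]≔ (λ c → x c + a * y c)) ≡ detRows (W [ i ]≔ x) + a * detRows (W [ i ]≔ y)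
  detRows-linear W i a x y i< = begin
    detRows (W [ i ]≔ (λ c → x c + a * y c))
      ≡⟨ detRows-expand W i (λ c → x c + a * y c) i< ⟩
    ∑ (λ c → (x c + a * y c) * D c)
      ≡⟨ ∑-cong (λ c → trans (*-distribʳ-+ (D c) (x c) (a * y c)) (cong (_+_ (x c * D c)) (*-assoc a (y c) (D c)))) ⟩
    ∑ (λ c → x c * D c + a * (y c * D c))
      ≡⟨ ∑-distrib-+ (λ c → x c * D c) (λ c → a * (y c * D c)) ⟩
    ∑ (λ c → x c * D c) + ∑ (λ c → a * (y c * D c))
      ≡⟨ cong (_+_ (∑ (λ c → x c * D c))) (*-distribˡ-∑ a (λ c → y c * D c)) ⟨
    ∑ (λ c → x c * D c) + a * ∑ (λ c → y c * D c)
      ≡⟨ cong₂ (λ d e → d + a * e) (detRows-expand W i x i<) (detRows-expand W i y i<) ⟨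
    detRows (W [ i ]≔ x) + a * detRows (W [ i ]≔ y) ∎
    where D = λ c → detRows (W [ i ]≔ basis c)

  detRows-expand-head₂ : ∀ {n} (x y : Row n) V →
                         detRows (x ∷ y ∷ V) ≡ ∑ λ j → x j * ∑ λ c → y c * detRows (basis j ∷ basis c ∷ V)
  detRows-expand-head₂ x y V = trans (detRows-expand (x ∷ y ∷ V) 0 x (s≤s z≤n))
    (∑-cong λ j → cong (x j *_) (detRows-expand (basis j ∷ y ∷ V) 1 y (s≤s (s≤s z≤n))))

  detRows-minors-zero : ∀ {n} (x : Row (suc n)) xs → (∀ j → detRows (dropColumn j xs) ≡ + 0) → detRows (x ∷ xs) ≡ + 0
  detRows-minors-zero x xs minor≡0 = ∑-zero _ λ j → begin
    sign (toℕ j) * (x j * detRows (dropColumn j xs)) ≡⟨ cong (λ d → sign (toℕ j) * (x j * d)) (minor≡0 j) ⟩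
    sign (toℕ j) * (x j * + 0)                       ≡⟨ cong (sign (toℕ j) *_) (*-zeroʳ (x j)) ⟩
    sign (toℕ j) * + 0                               ≡⟨ *-zeroʳ (sign (toℕ j)) ⟩
    + 0                                              ∎

  basis-≢ : ∀ {n} {j k : Fin n} → j ≢ k → basis j k ≡ + 0
  basis-≢ {j = Fin.zero}  {Fin.zero}  j≢k = ⊥-elim (j≢k refl)
  basis-≢ {j = Fin.zero}  {Fin.suc k} _   = refl
  basis-≢ {j = Fin.suc j} {Fin.zero}  _   = refl
  basis-≢ {j = Fin.suc j} {Fin.suc k} j≢k = basis-≢ (j≢k ∘ cong Fin.suc)

  basis-diag : ∀ {n} (j : Fin n) → basis j j ≡ + 1
  basis-diag Fin.zero    = refl
  basis-diag (Fin.suc j) = basis-diag j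

  basis-punchIn : ∀ {n} {j c : Fin (suc n)} (j≢c : j ≢ c) → basis c ∘ punchIn j ≗ basis (punchOut j≢c)
  basis-punchIn {j = Fin.zero}  {Fin.zero}  j≢c l = ⊥-elim (j≢c refl)
  basis-punchIn {j = Fin.zero}  {Fin.suc c} j≢c l = refl
  basis-punchIn {suc n} {Fin.suc j} {Fin.zero}  j≢c Fin.zero    = refl
  basis-punchIn {suc n} {Fin.suc j} {Fin.zero}  j≢c (Fin.suc l) = refl
  basis-punchIn {suc n} {Fin.suc j} {Fin.suc c} j≢c Fin.zero    = refl
  basis-punchIn {suc n} {Fin.suc j} {Fin.suc c} j≢c (Fin.suc l) = basis-punchIn (j≢c ∘ cong Fin.suc) l

  punchIn-punchOut-comm : ∀ {n} {j c : Fin (suc (suc n))} (j≢c : j ≢ c) (c≢j : c ≢ j) l →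
                          punchIn j (punchIn (punchOut j≢c) l) ≡ punchIn c (punchIn (punchOut c≢j) l)
  punchIn-punchOut-comm {j = Fin.zero}  {Fin.zero}  j≢c _ _ = ⊥-elim (j≢c refl)
  punchIn-punchOut-comm {j = Fin.zero}  {Fin.suc c} _   _ _ = refl
  punchIn-punchOut-comm {j = Fin.suc j} {Fin.zero}  _   _ _ = refl
  punchIn-punchOut-comm {suc n} {Fin.suc j} {Fin.suc c} _ _ Fin.zero = refl
  punchIn-punchOut-comm {suc n} {Fin.suc j} {Fin.suc c} j≢c c≢j (Fin.suc l) =
    cong Fin.suc (punchIn-punchOut-comm (j≢c ∘ cong Fin.suc) (c≢j ∘ cong Fin.suc) l)

  sign-punchOut : ∀ {n} {j c : Fin (suc (suc n))} (j≢c : j ≢ c) (c≢j : c ≢ j) →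
                  sign (toℕ j) * sign (toℕ (punchOut j≢c)) ≡ - (sign (toℕ c) * sign (toℕ (punchOut c≢j)))
  sign-punchOut {j = Fin.zero}  {Fin.zero}  j≢c _ = ⊥-elim (j≢c refl)
  sign-punchOut {j = Fin.zero}  {Fin.suc c} _   _ = begin
    + 1 * sign (toℕ c)             ≡⟨ *-identityˡ (sign (toℕ c)) ⟩
    sign (toℕ c)                   ≡⟨ neg-involutive (sign (toℕ c)) ⟨
    - - sign (toℕ c)               ≡⟨ cong -_ (trans (*-identityʳ (sign (suc (toℕ c)))) (sign-suc (toℕ c))) ⟨
    - (sign (suc (toℕ c)) * + 1)   ∎
  sign-punchOut {j = Fin.suc j} {Fin.zero}  _   _ =
    trans (*-identityʳ _) (trans (sign-suc (toℕ j)) (cong -_ (sym (*-identityˡ _))))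
  sign-punchOut {zero}  {Fin.suc Fin.zero} {Fin.suc Fin.zero} j≢c _ = ⊥-elim (j≢c refl)
  sign-punchOut {suc n} {Fin.suc j} {Fin.suc c} j≢c c≢j = begin
    sign (suc (toℕ j)) * sign (suc (toℕ j′))   ≡⟨ sign-suc² (toℕ j) (toℕ j′) ⟩
    sign (toℕ j) * sign (toℕ j′)               ≡⟨ sign-punchOut (j≢c ∘ cong Fin.suc) (c≢j ∘ cong Fin.suc) ⟩
    - (sign (toℕ c) * sign (toℕ c′))           ≡⟨ cong -_ (sign-suc² (toℕ c) (toℕ c′)) ⟨
    - (sign (suc (toℕ c)) * sign (suc (toℕ c′))) ∎
    where
    j′ = punchOut (j≢c ∘ cong Fin.suc)
    c′ = punchOut (c≢j ∘ cong Fin.suc)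
    -x*-y≡x*y : ∀ x y → - x * - y ≡ x * y
    -x*-y≡x*y = solve-∀
    sign-suc² : ∀ a b → sign (suc a) * sign (suc b) ≡ sign a * sign b
    sign-suc² a b = trans (cong₂ _*_ (sign-suc a) (sign-suc b)) (-x*-y≡x*y (sign a) (sign b))

  dropColumn-twice : ∀ {n} {a a′ : Fin (suc n)} {b b′ : Fin (suc (suc n))} →
                     (∀ l → punchIn b (punchIn a l) ≡ punchIn b′ (punchIn a′ l)) →
                     ∀ V → dropColumn a (dropColumn b V) ≋ dropColumn a′ (dropColumn b′ V)
  dropColumn-twice eq []      = []
  dropColumn-twice eq (w ∷ V) = (cong w ∘ eq) ∷ dropColumn-twice eq V

  detRows-zero-head : ∀ {n} (z : Row n) V → (∀ c → z c ≡ + 0) → detRows (z ∷ V) ≡ + 0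
  detRows-zero-head {zero}  z V z≗0 = refl
  detRows-zero-head {suc n} z V z≗0 = ∑-zero _ λ j → begin
    sign (toℕ j) * (z j * detRows (dropColumn j V)) ≡⟨ cong (λ a → sign (toℕ j) * (a * detRows (dropColumn j V))) (z≗0 j) ⟩
    sign (toℕ j) * + 0                              ≡⟨ *-zeroʳ (sign (toℕ j)) ⟩
    + 0                                             ∎

  detRows-basis-repeat : ∀ {n} (j : Fin (suc n)) V → detRows (basis j ∷ basis j ∷ V) ≡ + 0
  detRows-basis-repeat j V = begin
    detRows (basis j ∷ basis j ∷ V)                             ≡⟨ detRows-basis-head j (basis j ∷ V) ⟩
    sign (toℕ j) * detRows (basis j ∘ punchIn j ∷ dropColumn j V) ≡⟨ cong (sign (toℕ j) *_) (detRows-zero-head _ _ λ l →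
                                                                     basis-≢ (punchInᵢ≢i j l ∘ sym)) ⟩
    sign (toℕ j) * + 0                                          ≡⟨ *-zeroʳ (sign (toℕ j)) ⟩
    + 0                                                         ∎

  detRows-basis-pair : ∀ {n} {j c : Fin (suc (suc n))} (j≢c : j ≢ c) V →
                       detRows (basis j ∷ basis c ∷ V) ≡
                       sign (toℕ j) * sign (toℕ (punchOut j≢c)) * detRows (dropColumn (punchOut j≢c) (dropColumn j V))
  detRows-basis-pair {j = j} {c} j≢c V = begin
    detRows (basis j ∷ basis c ∷ V)
      ≡⟨ detRows-basis-head j (basis c ∷ V) ⟩
    sign (toℕ j) * detRows (basis c ∘ punchIn j ∷ dropColumn j V)
      ≡⟨ cong (sign (toℕ j) *_) (detRows-cong (basis-punchIn j≢c ∷ ≋-refl)) ⟩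
    sign (toℕ j) * detRows (basis j′ ∷ dropColumn j V)
      ≡⟨ cong (sign (toℕ j) *_) (detRows-basis-head j′ (dropColumn j V)) ⟩
    sign (toℕ j) * (sign (toℕ j′) * detRows (dropColumn j′ (dropColumn j V)))
      ≡⟨ *-assoc (sign (toℕ j)) (sign (toℕ j′)) _ ⟨
    sign (toℕ j) * sign (toℕ j′) * detRows (dropColumn j′ (dropColumn j V)) ∎
    where j′ = punchOut j≢c

  detRows-basis-swap-≢ : ∀ {n} {j c : Fin (suc n)} → j ≢ c → ∀ V →
                         detRows (basis j ∷ basis c ∷ V) ≡ - detRows (basis c ∷ basis j ∷ V)
  detRows-basis-swap-≢ {zero}  {Fin.zero} {Fin.zero} j≢c V = ⊥-elim (j≢c refl)
  detRows-basis-swap-≢ {suc n} {j} {c} j≢c V = begin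
    detRows (basis j ∷ basis c ∷ V)
      ≡⟨ detRows-basis-pair j≢c V ⟩
    sign (toℕ j) * sign (toℕ j′) * detRows (dropColumn j′ (dropColumn j V))
      ≡⟨ cong₂ _*_ (sign-punchOut j≢c c≢j) (detRows-cong (dropColumn-twice (punchIn-punchOut-comm j≢c c≢j) V)) ⟩
    - (sign (toℕ c) * sign (toℕ c′)) * detRows (dropColumn c′ (dropColumn c V))
      ≡⟨ neg-distribˡ-* (sign (toℕ c) * sign (toℕ c′)) _ ⟨
    - (sign (toℕ c) * sign (toℕ c′) * detRows (dropColumn c′ (dropColumn c V)))
      ≡⟨ cong -_ (detRows-basis-pair c≢j V) ⟨
    - detRows (basis c ∷ basis j ∷ V) ∎
    where
    c≢j = j≢c ∘ sym
    j′ = punchOut j≢c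
    c′ = punchOut c≢j

  detRows-basis-swap : ∀ {n} (j c : Fin (suc n)) V → detRows (basis j ∷ basis c ∷ V) ≡ - detRows (basis c ∷ basis j ∷ V)
  detRows-basis-swap j c V with j Fin.≟ c
  ... | yes refl = trans (detRows-basis-repeat j V) (cong -_ (sym (detRows-basis-repeat j V)))
  ... | no j≢c   = detRows-basis-swap-≢ j≢c V

  detRows-swap-head : ∀ {n} (x y : Row n) V → detRows (x ∷ y ∷ V) ≡ - detRows (y ∷ x ∷ V)
  detRows-swap-head {zero}  x y V = refl
  detRows-swap-head {suc n} x y V = begin
    detRows (x ∷ y ∷ V)                        ≡⟨ detRows-expand-head₂ x y V ⟩
    ∑ (λ j → x j * ∑ λ c → y c * D j c)         ≡⟨ ∑-cong (λ j → *-distribˡ-∑ (x j) (λ c → y c * D j c)) ⟩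
    ∑ (λ j → ∑ λ c → x j * (y c * D j c))       ≡⟨ ∑-cong (λ j → ∑-cong λ c → swapped j c) ⟩
    ∑ (λ j → ∑ λ c → - (y c * (x j * D c j)))   ≡⟨ ∑-cong (λ j → ∑-neg (λ c → y c * (x j * D c j))) ⟩
    ∑ (λ j → - ∑ λ c → y c * (x j * D c j))     ≡⟨ ∑-neg (λ j → ∑ λ c → y c * (x j * D c j)) ⟩
    - ∑ (λ j → ∑ λ c → y c * (x j * D c j))     ≡⟨ cong -_ (∑-comm (λ j c → y c * (x j * D c j))) ⟩
    - ∑ (λ c → ∑ λ j → y c * (x j * D c j))     ≡⟨ cong -_ (∑-cong λ c → *-distribˡ-∑ (y c) (λ j → x j * D c j)) ⟨
    - ∑ (λ c → y c * ∑ λ j → x j * D c j)       ≡⟨ cong -_ (detRows-expand-head₂ y x V) ⟨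
    - detRows (y ∷ x ∷ V)                      ∎
    where
    D : Fin (suc n) → Fin (suc n) → ℤ
    D j c = detRows (basis j ∷ basis c ∷ V)
    rearrange : ∀ a b d → a * (b * - d) ≡ - (b * (a * d))
    rearrange = solve-∀
    swapped : ∀ j c → x j * (y c * D j c) ≡ - (y c * (x j * D c j))
    swapped j c = trans (cong (λ d → x j * (y c * d)) (detRows-basis-swap j c V)) (rearrange (x j) (y c) (D c j))

  i≡-i⇒i≡0 : ∀ {i} → i ≡ - i → i ≡ + 0
  i≡-i⇒i≡0 {+ zero} _ = refl

  detRows-repeat-head : ∀ {n} (x : Row n) V → detRows (x ∷ x ∷ V) ≡ + 0
  detRows-repeat-head x V = i≡-i⇒i≡0 (detRows-swap-head x x V)

  detRows-row-head : ∀ {n} (x : Row n) xs k → k < length xs → x ≗ row xs k → detRows (x ∷ xs) ≡ + 0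
  detRows-row-head x (z ∷ zs) zero _ x≗z =
    trans (detRows-cong ((λ _ → refl) ∷ (sym ∘ x≗z) ∷ ≋-refl)) (detRows-repeat-head x zs)
  detRows-row-head {zero}  x (z ∷ zs) (suc k) _ _ = refl
  detRows-row-head {suc n} x (z ∷ zs) (suc k) (s≤s k<) x≗ =
    trans (detRows-swap-head x z zs) (cong -_ (detRows-minors-zero z (x ∷ zs) minor≡0))
    where
    minor≡0 : ∀ j → detRows (x ∘ punchIn j ∷ dropColumn j zs) ≡ + 0
    minor≡0 j = detRows-row-head (x ∘ punchIn j) (dropColumn j zs) k (<-length-dropColumn j zs k<)
      (λ l → trans (x≗ (punchIn j l)) (sym (cong-app (row-dropColumn j zs k) l)))

  detRows-equal-rows : ∀ {n} (W : List (Row n)) {i j} → i ≢ j → i < length W → j < length W →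
                       row W i ≗ row W j → detRows W ≡ + 0
  detRows-equal-rows (x ∷ xs) {zero}  {zero}  i≢j _ _ _ = ⊥-elim (i≢j refl)
  detRows-equal-rows (x ∷ xs) {zero}  {suc j} _ _ (s≤s j<) eq = detRows-row-head x xs j j< eq
  detRows-equal-rows (x ∷ xs) {suc i} {zero}  _ (s≤s i<) _ eq = detRows-row-head x xs i i< (sym ∘ eq)
  detRows-equal-rows {zero}  (x ∷ xs) {suc i} {suc j} _ _ _ _ = refl
  detRows-equal-rows {suc n} (x ∷ xs) {suc i} {suc j} i≢j (s≤s i<) (s≤s j<) eq = detRows-minors-zero x xs λ c →
    detRows-equal-rows (dropColumn c xs) (i≢j ∘ cong suc) (<-length-dropColumn c xs i<) (<-length-dropColumn c xs j<)
      λ l → trans (cong-app (row-dropColumn c xs i) l) (trans (eq (punchIn c l)) (sym (cong-app (row-dropColumn c xs j) l)))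

  addRow : ∀ {n} → ℕ → ℕ → ℤ → List (Row n) → List (Row n)
  addRow i j a W = W [ i ]≔ (λ c → row W i c + a * row W j c)

  detRows-addRow : ∀ {n} (W : List (Row n)) {i j} a → i ≢ j → i < length W → j < length W →
                   detRows (addRow i j a W) ≡ detRows W
  detRows-addRow W {i} {j} a i≢j i< j< = begin
    detRows (addRow i j a W)                                   ≡⟨ detRows-linear W i a (row W i) (row W j) i< ⟩
    detRows (W [ i ]≔ row W i) + a * detRows (W [ i ]≔ row W j) ≡⟨ cong₂ (λ d e → d + a * e) (cong detRows (≔-row W i)) repeated ⟩
    detRows W + a * + 0                                        ≡⟨ cong (_+_ (detRows W)) (*-zeroʳ a) ⟩
    detRows W + + 0                                            ≡⟨ +-identityʳ (detRows W) ⟩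
    detRows W                                                  ∎
    where
    W′ = W [ i ]≔ row W j
    <-length-W′ : ∀ {k} → k < length W → k < length W′
    <-length-W′ = subst (_ <_) (sym (length-≔ W i (row W j)))
    repeated : detRows W′ ≡ + 0
    repeated = detRows-equal-rows W′ i≢j (<-length-W′ i<) (<-length-W′ j<)
      (cong-app (trans (row-≔-same W i (row W j) i<) (sym (row-≔-other W (row W j) i≢j))))

  detRows-zero-column : ∀ {n} (V : List (Row (suc n))) → (∀ k → row V k Fin.zero ≡ + 0) → detRows V ≡ + 0
  detRows-minor-suc : ∀ {n} (V : List (Row (suc n))) (j : Fin n) → (∀ k → row V k Fin.zero ≡ + 0) →
                      detRows (dropColumn (Fin.suc j) V) ≡ + 0
  detRows-block : ∀ {n} (y : Row (suc n)) V → (∀ k → row V k Fin.zero ≡ + 0) →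
                  detRows (y ∷ V) ≡ y Fin.zero * detRows (map Vector.tail V)

  detRows-zero-column []       _     = refl
  detRows-zero-column (x ∷ xs) col≡0 =
    trans (detRows-block x xs (col≡0 ∘ suc)) (cong (_* detRows (map Vector.tail xs)) (col≡0 0))

  detRows-minor-suc {suc n} V j col≡0 = detRows-zero-column (dropColumn (Fin.suc j) V)
    λ k → trans (cong-app (row-dropColumn (Fin.suc j) V k) Fin.zero) (col≡0 k)

  detRows-block y V col≡0 = begin
    + 1 * (y Fin.zero * D) + ∑ (λ j → sign (toℕ (Fin.suc j)) * (y (Fin.suc j) * detRows (dropColumn (Fin.suc j) V)))
      ≡⟨ cong (_+_ (+ 1 * (y Fin.zero * D))) (∑-zero _ λ j →
           trans (cong (λ d → sign (toℕ (Fin.suc j)) * (y (Fin.suc j) * d)) (detRows-minor-suc V j col≡0))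
                 (trans (cong (sign (toℕ (Fin.suc j)) *_) (*-zeroʳ (y (Fin.suc j)))) (*-zeroʳ (sign (toℕ (Fin.suc j)))))) ⟩
    + 1 * (y Fin.zero * D) + + 0
      ≡⟨ +-identityʳ _ ⟩
    + 1 * (y Fin.zero * D)
      ≡⟨ *-identityˡ _ ⟩
    y Fin.zero * D ∎
    where D = detRows (map Vector.tail V)

  infix 4 _≡±_
  _≡±_ : ℤ → ℤ → Set
  a ≡± b = a ≡ b ⊎ a ≡ - b

  ≡⇒≡± : ∀ {a b} → a ≡ b → a ≡± b
  ≡⇒≡± = inj₁

  ≡±-sym : ∀ {a b} → a ≡± b → b ≡± a
  ≡±-sym (inj₁ refl) = inj₁ refl
  ≡±-sym {b = b} (inj₂ refl) = inj₂ (sym (neg-involutive b))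

  ≡±-trans : ∀ {a b c} → a ≡± b → b ≡± c → a ≡± c
  ≡±-trans (inj₁ refl) b≡±c         = b≡±c
  ≡±-trans (inj₂ refl) (inj₁ refl)  = inj₂ refl
  ≡±-trans {c = c} (inj₂ refl) (inj₂ refl) = inj₁ (neg-involutive c)

  sign-*-≡± : ∀ k a → sign k * a ≡± a
  sign-*-≡± zero          a = inj₁ (*-identityˡ a)
  sign-*-≡± (suc zero)    a = inj₂ (-1*i≡-i a)
  sign-*-≡± (suc (suc k)) a = sign-*-≡± k a

  *-congˡ-≡± : ∀ c {a b} → a ≡± b → c * a ≡± c * b
  *-congˡ-≡± c (inj₁ refl) = inj₁ refl
  *-congˡ-≡± c {b = b} (inj₂ refl) = inj₂ (sym (neg-distribʳ-* c b))

  IsUnit : ℤ → Set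
  IsUnit d = d ≡ + 1 ⊎ d ≡ -[1+ 0 ]

  IsUnit-resp-≡± : ∀ {a b} → a ≡± b → IsUnit b → IsUnit a
  IsUnit-resp-≡± (inj₁ refl) u           = u
  IsUnit-resp-≡± (inj₂ refl) (inj₁ refl) = inj₂ refl
  IsUnit-resp-≡± (inj₂ refl) (inj₂ refl) = inj₁ refl

  IsUnit-*⁻ : ∀ a b → IsUnit (a * b) → IsUnit a × IsUnit b
  IsUnit-*⁻ a b u = fromAbs (ℕ.m*n≡1⇒m≡1 ∣ a ∣ ∣ b ∣ ∣ab∣≡1) , fromAbs (ℕ.m*n≡1⇒n≡1 ∣ a ∣ ∣ b ∣ ∣ab∣≡1)
    where
    fromAbs : ∀ {c} → ∣ c ∣ ≡ 1 → IsUnit c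
    fromAbs {+ .1}           refl = inj₁ refl
    fromAbs { -[1+ zero ]}   refl = inj₂ refl
    ∣ab∣≡1 : ∣ a ∣ ℕ.* ∣ b ∣ ≡ 1
    ∣ab∣≡1 = trans (sym (abs-* a b)) (toAbs u)
      where
      toAbs : ∀ {c} → IsUnit c → ∣ c ∣ ≡ 1
      toAbs (inj₁ refl) = refl
      toAbs (inj₂ refl) = refl

  module _ {A : Set} where

    drop-++-≤ : ∀ i (X Y : List A) → i ≤ length X → drop i (X ++ Y) ≡ drop i X ++ Y
    drop-++-≤ zero    X       Y _         = refl
    drop-++-≤ (suc i) (x ∷ X) Y (s≤s i≤) = drop-++-≤ i X Y i≤

    take-++-≤ : ∀ k (X Y : List A) → k ≤ length X → take k (X ++ Y) ≡ take k X
    take-++-≤ zero    X       Y _         = refl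
    take-++-≤ (suc k) (x ∷ X) Y (s≤s k≤) = cong (x ∷_) (take-++-≤ k X Y k≤)

    drop-++-length : ∀ (X Y : List A) m → drop (length X ℕ.+ m) (X ++ Y) ≡ drop m Y
    drop-++-length []      Y m = refl
    drop-++-length (x ∷ X) Y m = drop-++-length X Y m

    take-++-length : ∀ (X Y : List A) m → take (length X ℕ.+ m) (X ++ Y) ≡ X ++ take m Y
    take-++-length []      Y m = refl
    take-++-length (x ∷ X) Y m = cong (x ∷_) (take-++-length X Y m)

  detRows-snoc : ∀ {n} xs (x : Row n) → detRows (xs ++ [ x ]) ≡ sign (length xs) * detRows (x ∷ xs)
  detRows-snoc          []       x = sym (*-identityˡ _)
  detRows-snoc {zero}  (y ∷ ys) x = sym (*-zeroʳ (sign (suc (length ys))))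
  detRows-snoc {suc n} (y ∷ ys) x = begin
    ∑ (λ j → sign (toℕ j) * (y j * detRows (dropColumn j (ys ++ [ x ]))))
      ≡⟨ ∑-cong (λ j → cong (λ d → sign (toℕ j) * (y j * d)) (minor-snoc j)) ⟩
    ∑ (λ j → sign (toℕ j) * (y j * (σ * D j)))
      ≡⟨ ∑-cong (λ j → trans (cong (sign (toℕ j) *_) (x∙yz≈y∙xz (y j) σ (D j))) (x∙yz≈y∙xz (sign (toℕ j)) σ _)) ⟩
    ∑ (λ j → σ * (sign (toℕ j) * (y j * D j)))
      ≡⟨ *-distribˡ-∑ σ (λ j → sign (toℕ j) * (y j * D j)) ⟨
    σ * detRows (y ∷ x ∷ ys)
      ≡⟨ cong (σ *_) (detRows-swap-head y x ys) ⟩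
    σ * - detRows (x ∷ y ∷ ys)
      ≡⟨ neg-distribʳ-* σ _ ⟨
    - (σ * detRows (x ∷ y ∷ ys))
      ≡⟨ neg-distribˡ-* σ _ ⟩
    - σ * detRows (x ∷ y ∷ ys)
      ≡⟨ cong (_* detRows (x ∷ y ∷ ys)) (sign-suc (length ys)) ⟨
    sign (suc (length ys)) * detRows (x ∷ y ∷ ys) ∎
    where
    σ = sign (length ys)
    D = λ j → detRows (x ∘ punchIn j ∷ dropColumn j ys)
    minor-snoc : ∀ j → detRows (dropColumn j (ys ++ [ x ])) ≡ σ * D j
    minor-snoc j = begin
      detRows (dropColumn j (ys ++ [ x ]))                 ≡⟨ cong detRows (List.map-++ (_∘ punchIn j) ys [ x ]) ⟩
      detRows (dropColumn j ys ++ [ x ∘ punchIn j ])       ≡⟨ detRows-snoc (dropColumn j ys) (x ∘ punchIn j) ⟩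
      sign (length (dropColumn j ys)) * D j                ≡⟨ cong (λ k → sign k * D j) (length-dropColumn j ys) ⟩
      σ * D j                                              ∎

  detRows-rotate : ∀ {n} t (W : List (Row n)) → t ≤ length W → detRows (drop t W ++ take t W) ≡± detRows W
  detRows-rotate zero    W       _        = ≡⇒≡± (cong detRows (List.++-identityʳ W))
  detRows-rotate (suc t) (x ∷ X) (s≤s t≤) = ≡±-trans (≡⇒≡± (cong detRows rotated))
    (≡±-trans (detRows-rotate t (X ++ [ x ]) (ℕ.≤-trans t≤ (List.length-++-≤ˡ X)))
              (≡±-trans (≡⇒≡± (detRows-snoc X x)) (sign-*-≡± (length X) (detRows (x ∷ X)))))
    where
    rotated : drop t X ++ x ∷ take t X ≡ drop t (X ++ [ x ]) ++ take t (X ++ [ x ])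
    rotated = begin
      drop t X ++ x ∷ take t X                      ≡⟨ List.++-assoc (drop t X) [ x ] (take t X) ⟨
      (drop t X ++ [ x ]) ++ take t X               ≡⟨ cong₂ _++_ (drop-++-≤ t X [ x ] t≤) (take-++-≤ t X [ x ] t≤) ⟨
      drop t (X ++ [ x ]) ++ take t (X ++ [ x ])    ∎

  -- Walks by one-row changes and windows of stacked row lists

  infix 4 _≋₁_
  data _≋₁_ {n} : List (Row n) → List (Row n) → Set where
    []    : [] ≋₁ []
    here  : ∀ {x y xs ys} → xs ≋ ys → x ∷ xs ≋₁ y ∷ ys
    there : ∀ {x y xs ys} → x ≗ y → xs ≋₁ ys → x ∷ xs ≋₁ y ∷ ys

  ≋⇒≋₁ : ∀ {n} {xs ys : List (Row n)} → xs ≋ ys → xs ≋₁ ys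
  ≋⇒≋₁ []            = []
  ≋⇒≋₁ (x≗y ∷ xs≋ys) = here xs≋ys

  ≋₁-sym : ∀ {n} {xs ys : List (Row n)} → xs ≋₁ ys → ys ≋₁ xs
  ≋₁-sym []                = []
  ≋₁-sym (here xs≋ys)      = here (≋-sym xs≋ys)
  ≋₁-sym (there x≗y xs≋ys) = there (sym ∘ x≗y) (≋₁-sym xs≋ys)

  ≋₁-length : ∀ {n} {xs ys : List (Row n)} → xs ≋₁ ys → length xs ≡ length ys
  ≋₁-length []              = refl
  ≋₁-length (here xs≋ys)    = cong suc (Pointwise.Pointwise-length xs≋ys)
  ≋₁-length (there _ xs≋ys) = cong suc (≋₁-length xs≋ys)

  ≔-≋₁ : ∀ {n} (W : List (Row n)) i y → W ≋₁ W [ i ]≔ y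
  ≔-≋₁ []       _       _ = []
  ≔-≋₁ (x ∷ xs) zero    _ = here ≋-refl
  ≔-≋₁ (x ∷ xs) (suc i) y = there (λ _ → refl) (≔-≋₁ xs i y)

  ≋₁-take-or-drop : ∀ {n} {xs ys : List (Row n)} → xs ≋₁ ys → ∀ i → take i xs ≋ take i ys ⊎ drop i xs ≋ drop i ys
  ≋₁-take-or-drop xs≋₁ys             zero    = inj₁ []
  ≋₁-take-or-drop []                 (suc i) = inj₁ []
  ≋₁-take-or-drop (here xs≋ys)       (suc i) = inj₂ (≋-drop i xs≋ys)
  ≋₁-take-or-drop (there x≗y xs≋₁ys) (suc i) with ≋₁-take-or-drop xs≋₁ys i
  ... | inj₁ take≋ = inj₁ (x≗y ∷ take≋)
  ... | inj₂ drop≋ = inj₂ drop≋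

  RowStep : ∀ {n} → List (Row n) → List (Row n) → Set
  RowStep W V = W ≋₁ V × detRows V ≡± detRows W

  RowStep-sym : ∀ {n} {W V : List (Row n)} → RowStep W V → RowStep V W
  RowStep-sym (W≋₁V , det±) = ≋₁-sym W≋₁V , ≡±-sym det±

  ≋⇒RowStep : ∀ {n} {W V : List (Row n)} → W ≋ V → RowStep W V
  ≋⇒RowStep W≋V = ≋⇒≋₁ W≋V , ≡⇒≡± (detRows-cong (≋-sym W≋V))

  RowStep-IsUnit : ∀ {n} {W V : List (Row n)} → Star RowStep W V → IsUnit (detRows W) → IsUnit (detRows V)
  RowStep-IsUnit ε                  u = u
  RowStep-IsUnit ((_ , det±) ◅ steps) u = RowStep-IsUnit steps (IsUnit-resp-≡± det± u)

  RowStep-length : ∀ {n} {W V : List (Row n)} → Star RowStep W V → length V ≡ length W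
  RowStep-length ε                    = refl
  RowStep-length ((W≋₁V , _) ◅ steps) = trans (RowStep-length steps) (sym (≋₁-length W≋₁V))

  UnimodularWindows : ∀ r → List (Row r) → Set
  UnimodularWindows r L = ∀ i → i ℕ.+ r ≤ length L → IsUnit (detRows (take r (drop i L)))

  window-++ : ∀ {A : Set} (W V : List A) i → i ≤ length W → take (length W) (drop i (W ++ V)) ≡ drop i W ++ take i V
  window-++ W V i i≤ = begin
    take (length W) (drop i (W ++ V))          ≡⟨ cong (take (length W)) (drop-++-≤ i W V i≤) ⟩
    take (length W) (drop i W ++ V)            ≡⟨ cong (λ k → take k (drop i W ++ V)) length-split ⟩
    take (length (drop i W) ℕ.+ i) (drop i W ++ V) ≡⟨ take-++-length (drop i W) V i ⟩
    drop i W ++ take i V                       ∎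
    where
    length-split : length W ≡ length (drop i W) ℕ.+ i
    length-split = trans (sym (ℕ.m∸n+n≡m i≤)) (cong (ℕ._+ i) (sym (List.length-drop i W)))

  -- The windows of W ++ V are cyclic rotations of W or of V, since W and V differ in one row only.
  RowStep-windows : ∀ {r} {W V : List (Row r)} → length W ≡ r → IsUnit (detRows W) → RowStep W V →
                    UnimodularWindows r (W ++ V)
  RowStep-windows {r} {W} {V} lenW u (W≋₁V , det±) i i+r≤ =
    subst IsUnit (sym (cong detRows window≡)) (unit (≋₁-take-or-drop W≋₁V i))
    where
    i≤r : i ≤ length W
    i≤r = ℕ.+-cancelʳ-≤ r i (length W) (ℕ.≤-trans i+r≤ (ℕ.≤-reflexive
            (trans (List.length-++ W) (cong (length W ℕ.+_) (trans (sym (≋₁-length W≋₁V)) lenW)))))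
    window≡ : take r (drop i (W ++ V)) ≡ drop i W ++ take i V
    window≡ = subst (λ k → take k (drop i (W ++ V)) ≡ drop i W ++ take i V) lenW (window-++ W V i i≤r)
    i≤r′ : i ≤ length V
    i≤r′ = subst (i ≤_) (≋₁-length W≋₁V) i≤r
    unit : take i W ≋ take i V ⊎ drop i W ≋ drop i V → IsUnit (detRows (drop i W ++ take i V))
    unit (inj₁ take≋) = IsUnit-resp-≡±
      (≡±-trans (≡⇒≡± (detRows-cong (Pointwise.++⁺ ≋-refl (≋-sym take≋)))) (detRows-rotate i W i≤r)) u
    unit (inj₂ drop≋) = IsUnit-resp-≡±
      (≡±-trans (≡⇒≡± (detRows-cong (Pointwise.++⁺ drop≋ ≋-refl))) (≡±-trans (detRows-rotate i V i≤r′) det±)) u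

  -- Every window of length r of A ++ V ++ C lies inside A ++ V or inside V ++ C.
  windows-glue : ∀ {r} (A V C : List (Row r)) → length V ≡ r →
                 UnimodularWindows r (A ++ V) → UnimodularWindows r (V ++ C) → UnimodularWindows r (A ++ V ++ C)
  windows-glue {r} A V C lenV uAV uVC i i+r≤ with i ℕ.≤? length A
  ... | yes i≤ = subst IsUnit (cong detRows (sym inside-AV)) (uAV i (ℕ.≤-trans (ℕ.+-monoˡ-≤ r i≤)
                   (ℕ.≤-reflexive (trans (cong (length A ℕ.+_) (sym lenV)) (sym (List.length-++ A))))))
    where
    r≤ : r ≤ length (drop i A ++ V)
    r≤ = subst (_≤ length (drop i A ++ V)) lenV (List.length-++-≤ʳ V {drop i A})
    inside-AV : take r (drop i (A ++ V ++ C)) ≡ take r (drop i (A ++ V))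
    inside-AV = begin
      take r (drop i (A ++ V ++ C))   ≡⟨ cong (take r) (drop-++-≤ i A (V ++ C) i≤) ⟩
      take r (drop i A ++ V ++ C)     ≡⟨ cong (take r) (List.++-assoc (drop i A) V C) ⟨
      take r ((drop i A ++ V) ++ C)   ≡⟨ take-++-≤ r (drop i A ++ V) C r≤ ⟩
      take r (drop i A ++ V)          ≡⟨ cong (take r) (drop-++-≤ i A V i≤) ⟨
      take r (drop i (A ++ V))        ∎
  ... | no i≰ = subst IsUnit (cong detRows (sym inside-VC)) (uVC m m+r≤)
    where
    m = i ∸ length A
    i≡ : length A ℕ.+ m ≡ i
    i≡ = ℕ.m+[n∸m]≡n (ℕ.<⇒≤ (ℕ.≰⇒> i≰))
    inside-VC : take r (drop i (A ++ V ++ C)) ≡ take r (drop m (V ++ C))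
    inside-VC = cong (take r) (trans (cong (λ k → drop k (A ++ V ++ C)) (sym i≡)) (drop-++-length A (V ++ C) m))
    m+r≤ : m ℕ.+ r ≤ length (V ++ C)
    m+r≤ = ℕ.+-cancelˡ-≤ (length A) (m ℕ.+ r) (length (V ++ C)) (ℕ.≤-trans
             (ℕ.≤-reflexive (trans (sym (ℕ.+-assoc (length A) m r)) (cong (ℕ._+ r) i≡)))
             (ℕ.≤-trans i+r≤ (ℕ.≤-reflexive (List.length-++ A))))

  RowStep-path-windows : ∀ {r} {W V : List (Row r)} → length W ≡ r → IsUnit (detRows W) → Star RowStep W V →
                         ∃[ X ] UnimodularWindows r (W ++ X ++ V)
  RowStep-path-windows lenW u ε = [] , RowStep-windows lenW u (≋⇒RowStep ≋-refl)
  RowStep-path-windows {r} {W} {V} lenW u (_◅_ {j = W′} step steps) =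
    let X , uW′XV = RowStep-path-windows lenW′ uW′ steps
    in W′ ++ X , subst (UnimodularWindows r) (cong (W ++_) (sym (List.++-assoc W′ X V)))
                   (windows-glue W W′ (X ++ V) lenW′ (RowStep-windows lenW u step) uW′XV)
    where
    lenW′ : length W′ ≡ r
    lenW′ = trans (sym (≋₁-length (proj₁ step))) lenW
    uW′ : IsUnit (detRows W′)
    uW′ = IsUnit-resp-≡± (proj₂ step) u

  -- Reduction to the identity by row additions

  row-oob : ∀ {n} (W : List (Row n)) k → length W ≤ k → row W k ≡ λ _ → + 0
  row-oob []      k       _         = refl
  row-oob (x ∷ W) (suc k) (s≤s W≤k) = row-oob W k W≤k

  nonzero-row-< : ∀ {n} (W : List (Row n)) k c → row W k c ≢ + 0 → k < length W
  nonzero-row-< W k c entry≢0 with k ℕ.<? length W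
  ... | yes k< = k<
  ... | no  k≮ = ⊥-elim (entry≢0 (cong-app (row-oob W k (ℕ.≮⇒≥ k≮)) c))

  RowStep-addRow : ∀ {n} (W : List (Row n)) {i j} a → i ≢ j → i < length W → j < length W →
                   RowStep W (addRow i j a W)
  RowStep-addRow W {i} a i≢j i< j< = ≔-≋₁ W i _ , ≡⇒≡± (detRows-addRow W a i≢j i< j<)

  <-length-addRow : ∀ {n} (W : List (Row n)) i j a {k} → k < length W → k < length (addRow i j a W)
  <-length-addRow W i j a = subst (_ <_) (sym (length-≔ W i _))

  -- Four row additions replacing the rows u, v at positions 0 and k by -v and u - q v.
  euclidMoves : ∀ {n} → ℕ → ℤ → List (Row n) → List (Row n)
  euclidMoves k q W = addRow k 0 (+ 1) (addRow 0 k (- + 1) (addRow k 0 (+ 1) (addRow 0 k (- q) W)))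

  euclidMoves-other : ∀ {n} (W : List (Row n)) {k} q l → l ≢ 0 → l ≢ k → row (euclidMoves k q W) l ≡ row W l
  euclidMoves-other W {k} q l l≢0 l≢k =
    trans (row-≔-other W₃ _ (l≢k ∘ sym)) (trans (row-≔-other W₂ _ (l≢0 ∘ sym))
      (trans (row-≔-other W₁ _ (l≢k ∘ sym)) (row-≔-other W _ (l≢0 ∘ sym))))
    where
    W₁ = addRow 0 k (- q) W
    W₂ = addRow k 0 (+ 1) W₁
    W₃ = addRow 0 k (- + 1) W₂

  module _ {n} (W : List (Row n)) {k} (q : ℤ) (k≢0 : k ≢ 0) (k< : k < length W) where

    private
      W₁ = addRow 0 k (- q) W
      W₂ = addRow k 0 (+ 1) W₁
      W₃ = addRow 0 k (- + 1) W₂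
      0< : 0 < length W
      0< = ℕ.≤-trans (s≤s z≤n) k<
      k<₂ : k < length W₂
      k<₂ = <-length-addRow W₁ k 0 (+ 1) (<-length-addRow W 0 k (- q) k<)
      0<₂ : 0 < length W₂
      0<₂ = <-length-addRow W₁ k 0 (+ 1) (<-length-addRow W 0 k (- q) 0<)

    euclidMoves-path : Star RowStep W (euclidMoves k q W)
    euclidMoves-path =
      RowStep-addRow W (- q) (k≢0 ∘ sym) 0< k< ◅
      RowStep-addRow W₁ (+ 1) k≢0 (<-length-addRow W 0 k (- q) k<) (<-length-addRow W 0 k (- q) 0<) ◅
      RowStep-addRow W₂ (- + 1) (k≢0 ∘ sym) 0<₂ k<₂ ◅
      RowStep-addRow W₃ (+ 1) k≢0 (<-length-addRow W₂ 0 k (- + 1) k<₂) (<-length-addRow W₂ 0 k (- + 1) 0<₂) ◅ ε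

    euclidMoves-row : row (euclidMoves k q W) k ≗ λ c → row W 0 c + (- q) * row W k c
    euclidMoves-row c = begin
      row (euclidMoves k q W) k c
        ≡⟨ cong-app (row-≔-same W₃ k _ (<-length-addRow W₂ 0 k (- + 1) k<₂)) c ⟩
      row W₃ k c + + 1 * row W₃ 0 c
        ≡⟨ cong₂ (λ u v → u + + 1 * v) (cong-app (row-≔-other W₂ _ (k≢0 ∘ sym)) c) (cong-app (row-≔-same W₂ 0 _ 0<₂) c) ⟩
      row W₂ k c + + 1 * (row W₂ 0 c + (- + 1) * row W₂ k c)
        ≡⟨ cancel (row W₂ k c) (row W₂ 0 c) ⟩
      row W₂ 0 c
        ≡⟨ cong-app (row-≔-other W₁ _ k≢0) c ⟩
      row W₁ 0 c
        ≡⟨ cong-app (row-≔-same W 0 _ 0<) c ⟩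
      row W 0 c + (- q) * row W k c ∎
      where
      cancel : ∀ u v → u + + 1 * (v + (- + 1) * u) ≡ v
      cancel = solve-∀

  euclid-round : ∀ {m} (W : List (Row (suc m))) k → row W (suc k) Fin.zero ≢ + 0 →
                 ∃[ W′ ] Star RowStep W W′ × ∣ row W′ (suc k) Fin.zero ∣ < ∣ row W (suc k) Fin.zero ∣ ×
                         (∀ l → l ≢ 0 → l ≢ suc k → row W′ l ≡ row W l)
  euclid-round W k b≢0 =
    euclidMoves (suc k) q W , euclidMoves-path W q (λ ()) k< ,
    subst (λ e → ∣ e ∣ < ∣ b ∣) (sym remainder) (n%d<d a b) , euclidMoves-other W q
    where
    a = row W 0 Fin.zero
    b = row W (suc k) Fin.zero
    instance
      b-nonZero : ℤ.NonZero b
      b-nonZero = ℤ.≢-nonZero b≢0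
    q = a ℤ./ b
    k< : suc k < length W
    k< = nonzero-row-< W (suc k) Fin.zero b≢0
    cancel : ∀ r q b → r + q * b + (- q) * b ≡ r
    cancel = solve-∀
    remainder : row (euclidMoves (suc k) q W) (suc k) Fin.zero ≡ + (a ℤ.% b)
    remainder = begin
      row (euclidMoves (suc k) q W) (suc k) Fin.zero ≡⟨ euclidMoves-row W q (λ ()) k< Fin.zero ⟩
      a + (- q) * b                                  ≡⟨ cong (λ x → x + (- q) * b) (a≡a%n+[a/n]*n a b) ⟩
      + (a ℤ.% b) + q * b + (- q) * b                ≡⟨ cancel (+ (a ℤ.% b)) q b ⟩
      + (a ℤ.% b)                                    ∎

  euclid : ∀ {m} fuel (W : List (Row (suc m))) k → ∣ row W (suc k) Fin.zero ∣ ≤ fuel →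
           ∃[ W′ ] Star RowStep W W′ × row W′ (suc k) Fin.zero ≡ + 0 × (∀ l → l ≢ 0 → l ≢ suc k → row W′ l ≡ row W l)
  euclid fuel W k ∣b∣≤ with row W (suc k) Fin.zero ℤ.≟ + 0
  ... | yes b≡0 = W , ε , b≡0 , λ _ _ _ → refl
  euclid zero       W k ∣b∣≤ | no b≢0 = ⊥-elim (b≢0 (∣i∣≡0⇒i≡0 (ℕ.n≤0⇒n≡0 ∣b∣≤)))
  euclid (suc fuel) W k ∣b∣≤ | no b≢0 =
    let W₁ , path₁ , smaller , same₁ = euclid-round W k b≢0
        W₂ , path₂ , cleared , same₂ = euclid fuel W₁ k (ℕ.≤-pred (ℕ.≤-trans smaller ∣b∣≤))
    in W₂ , path₁ ◅◅ path₂ , cleared , λ l l≢0 l≢K → trans (same₂ l l≢0 l≢K) (same₁ l l≢0 l≢K)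

  column-zero-extend : ∀ {n} {W₁ W₂ : List (Row n)} K c →
                       (∀ k → suc k < suc K → row W₁ (suc k) c ≡ + 0) → row W₂ (suc K) c ≡ + 0 →
                       (∀ l → l ≢ 0 → l ≢ suc K → row W₂ l ≡ row W₁ l) →
                       ∀ k → suc k < suc (suc K) → row W₂ (suc k) c ≡ + 0
  column-zero-extend K c cleared₁ clearedK same k (s≤s (s≤s k≤K)) with k ℕ.≟ K
  ... | yes refl = clearedK
  ... | no  k≢K  = trans (cong-app (same (suc k) (λ ()) (k≢K ∘ ℕ.suc-injective)) c)
                         (cleared₁ k (s≤s (ℕ.≤∧≢⇒< k≤K k≢K)))

  clear-column-below : ∀ {m} K (W : List (Row (suc m))) →
                       ∃[ W′ ] Star RowStep W W′ × (∀ k → suc k < K → row W′ (suc k) Fin.zero ≡ + 0)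
  clear-column-below zero          W = W , ε , λ _ ()
  clear-column-below (suc zero)    W = W , ε , λ { _ (s≤s ()) }
  clear-column-below (suc (suc K)) W =
    let W₁ , path₁ , cleared₁ = clear-column-below (suc K) W
        W₂ , path₂ , clearedK , same = euclid _ W₁ K ℕ.≤-refl
    in W₂ , path₁ ◅◅ path₂ , column-zero-extend {W₁ = W₁} {W₂} K Fin.zero cleared₁ clearedK same

  column-zero-beyond : ∀ {n} (W : List (Row n)) c → (∀ k → suc k < length W → row W (suc k) c ≡ + 0) →
                       ∀ k → row W (suc k) c ≡ + 0
  column-zero-beyond W c cleared k with suc k ℕ.<? length W
  ... | yes k< = cleared k k<
  ... | no  k≮ = cong-app (row-oob W (suc k) (ℕ.≮⇒≥ k≮)) c

  clear-column : ∀ {m} (W : List (Row (suc m))) → ∃[ W′ ] Star RowStep W W′ × (∀ k → row W′ (suc k) Fin.zero ≡ + 0)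
  clear-column W =
    let W′ , path , cleared = clear-column-below (length W) W
    in W′ , path , column-zero-beyond W′ Fin.zero (λ k → cleared k ∘ subst (suc k <_) (RowStep-length path))

  zeroFirst : ∀ {n} → Row n → Row (suc n)
  zeroFirst w = + 0 Vector.∷ w

  identityRows : ∀ n → List (Row n)
  identityRows n = tabulate basis

  map-tail-zeroFirst : ∀ {n} (V : List (Row n)) → map Vector.tail (map zeroFirst V) ≡ V
  map-tail-zeroFirst V = trans (sym (List.map-∘ V)) (List.map-id V)

  zeroFirst-column : ∀ {n} (V : List (Row n)) k → row (map zeroFirst V) k Fin.zero ≡ + 0
  zeroFirst-column []      _       = refl
  zeroFirst-column (x ∷ V) zero    = refl
  zeroFirst-column (x ∷ V) (suc k) = zeroFirst-column V k

  detRows-zeroFirst : ∀ {n} (x : Row (suc n)) V → detRows (x ∷ map zeroFirst V) ≡ x Fin.zero * detRows V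
  detRows-zeroFirst x V = trans (detRows-block x (map zeroFirst V) (zeroFirst-column V))
                                (cong (λ W → x Fin.zero * detRows W) (map-tail-zeroFirst V))

  identityRows-suc : ∀ m → identityRows (suc m) ≋ basis Fin.zero ∷ map zeroFirst (identityRows m)
  identityRows-suc m = (λ _ → refl) ∷ subst (tabulate (basis ∘ Fin.suc) ≋_) (sym (List.map-tabulate basis zeroFirst))
    (Pointwise.tabulate⁺ λ a → λ { Fin.zero → refl ; (Fin.suc c) → refl })

  detRows-identity : ∀ n → detRows (identityRows n) ≡ + 1
  detRows-identity zero    = refl
  detRows-identity (suc m) = begin
    detRows (identityRows (suc m))                            ≡⟨ detRows-cong (identityRows-suc m) ⟩
    detRows (basis Fin.zero ∷ map zeroFirst (identityRows m)) ≡⟨ detRows-zeroFirst (basis Fin.zero) (identityRows m) ⟩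
    + 1 * detRows (identityRows m)                            ≡⟨ cong (+ 1 *_) (detRows-identity m) ⟩
    + 1                                                       ∎

  map-zeroFirst-≋₁ : ∀ {n} {V V′ : List (Row n)} → V ≋₁ V′ → map zeroFirst V ≋₁ map zeroFirst V′
  map-zeroFirst-≋₁ []              = []
  map-zeroFirst-≋₁ (here V≋V′)     = here (Pointwise.map⁺ zeroFirst zeroFirst (Pointwise.map zeroFirst-cong V≋V′))
    where
    zeroFirst-cong : ∀ {x y} → x ≗ y → zeroFirst x ≗ zeroFirst y
    zeroFirst-cong x≗y Fin.zero    = refl
    zeroFirst-cong x≗y (Fin.suc c) = x≗y c
  map-zeroFirst-≋₁ (there x≗y V≋₁V′) = there (λ { Fin.zero → refl ; (Fin.suc c) → x≗y c }) (map-zeroFirst-≋₁ V≋₁V′)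

  RowStep-lift : ∀ {n} (x : Row (suc n)) {V V′ : List (Row n)} → RowStep V V′ →
                 RowStep (x ∷ map zeroFirst V) (x ∷ map zeroFirst V′)
  RowStep-lift x {V} {V′} (V≋₁V′ , det±) =
    there (λ _ → refl) (map-zeroFirst-≋₁ V≋₁V′) ,
    ≡±-trans (≡⇒≡± (detRows-zeroFirst x V′))
      (≡±-trans (*-congˡ-≡± (x Fin.zero) det±) (≡⇒≡± (sym (detRows-zeroFirst x V))))

  RowStep-normalise-head : ∀ {m} (y : Row (suc m)) → IsUnit (y Fin.zero) →
                           RowStep (y ∷ map zeroFirst (identityRows m)) (identityRows (suc m))
  RowStep-normalise-head {m} y u =
    here (≋-sym (Pointwise.tail (identityRows-suc m))) ,
    subst₂ _≡±_ (sym (detRows-identity (suc m)))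
      (sym (trans (detRows-zeroFirst y (identityRows m)) (cong (y Fin.zero *_) (detRows-identity m)))) (unit≡± u)
    where
    unit≡± : ∀ {a} → IsUnit a → + 1 ≡± a * + 1
    unit≡± (inj₁ refl) = inj₁ refl
    unit≡± (inj₂ refl) = inj₂ refl

  zeroFirst-tail : ∀ {n} (V : List (Row (suc n))) → (∀ k → row V k Fin.zero ≡ + 0) → V ≋ map zeroFirst (map Vector.tail V)
  zeroFirst-tail []      _     = []
  zeroFirst-tail (x ∷ V) col≡0 = (λ { Fin.zero → col≡0 0 ; (Fin.suc c) → refl }) ∷ zeroFirst-tail V (col≡0 ∘ suc)

  reduce-to-identity : ∀ n (W : List (Row n)) → IsUnit (detRows W) → Star RowStep W (identityRows n)
  reduce-pivoted : ∀ m (W : List (Row (suc m))) → (∀ k → row W (suc k) Fin.zero ≡ + 0) → IsUnit (detRows W) →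
                   Star RowStep W (identityRows (suc m))

  reduce-to-identity zero    []      _ = ε
  reduce-to-identity zero    (_ ∷ _) (inj₁ ())
  reduce-to-identity zero    (_ ∷ _) (inj₂ ())
  reduce-to-identity (suc m) W       u =
    let W′ , path , cleared = clear-column W
    in path ◅◅ reduce-pivoted m W′ cleared (RowStep-IsUnit path u)

  reduce-pivoted m []       _       (inj₁ ())
  reduce-pivoted m []       _       (inj₂ ())
  reduce-pivoted m (y ∷ ys) cleared u =
    ≋⇒RowStep ((λ _ → refl) ∷ zeroFirst-tail ys cleared) ◅
    gmap (λ V → y ∷ map zeroFirst V) (RowStep-lift y) (reduce-to-identity m ys′ unit-minor) ◅◅
    RowStep-normalise-head y unit-pivot ◅ ε
    where
    ys′ = map Vector.tail ys
    units : IsUnit (y Fin.zero) × IsUnit (detRows ys′)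
    units = IsUnit-*⁻ (y Fin.zero) (detRows ys′) (subst IsUnit (detRows-block y ys cleared) u)
    unit-pivot = proj₁ units
    unit-minor = proj₂ units

  unimodular-bridge : ∀ {r} (W : List (Row r)) → IsUnit (detRows W) →
                      ∃[ X ] ∃[ Y ] UnimodularWindows r (identityRows r ++ X ++ W ++ Y ++ identityRows r)
  unimodular-bridge {r} W u =
    let X , windows-IW = RowStep-path-windows length-I unit-I (reverse RowStep-sym to-identity)
        Y , windows-WI = RowStep-path-windows length-W u to-identity
    in X , Y , subst (UnimodularWindows r) (List.++-assoc Id X (W ++ Y ++ Id))
                 (windows-glue (Id ++ X) W (Y ++ Id) length-W
                   (subst (UnimodularWindows r) (sym (List.++-assoc Id X W)) windows-IW) windows-WI)
    where
    Id = identityRows r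
    to-identity = reduce-to-identity r W u
    length-W : length W ≡ r
    length-W = trans (sym (RowStep-length to-identity)) (List.length-tabulate basis)
    length-I : length Id ≡ r
    length-I = List.length-tabulate basis
    unit-I : IsUnit (detRows Id)
    unit-I = inj₁ (detRows-identity r)

  UnimodularWindows-cong : ∀ {r} {L L′ : List (Row r)} → L ≋ L′ → UnimodularWindows r L′ → UnimodularWindows r L
  UnimodularWindows-cong {r} L≋L′ windows i i+r≤ =
    subst IsUnit (detRows-cong (≋-sym (≋-take r (≋-drop i L≋L′))))
      (windows i (subst (i ℕ.+ r ≤_) (Pointwise.Pointwise-length L≋L′) i+r≤))

  tabulate-⊘ : ∀ {m n r} (A : Matrix m r) (B : Matrix n r) → tabulate (A ⊘ B) ≡ tabulate A ++ tabulate B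
  tabulate-⊘ {zero}  A B = refl
  tabulate-⊘ {suc m} A B = cong (A Fin.zero ∷_) (trans (List.tabulate-cong split-suc) (tabulate-⊘ (A ∘ Fin.suc) B))
    where
    split-suc : ∀ i → (A ⊘ B) (Fin.suc i) ≡ ((A ∘ Fin.suc) ⊘ B) i
    split-suc i with Fin.splitAt m i
    ... | inj₁ _ = refl
    ... | inj₂ _ = refl

  drop-tabulate : ∀ {A : Set} {s} (f : Fin s → A) i (i<s : i < s) →
                  drop i (tabulate f) ≡ f (fromℕ< i<s) ∷ drop (suc i) (tabulate f)
  drop-tabulate {s = suc s} f zero    _         = refl
  drop-tabulate {s = suc s} f (suc i) (s≤s i<s) = drop-tabulate (f ∘ Fin.suc) i i<s

  tabulate-shift : ∀ {A : Set} {s r} (f : Fin s → A) i (g : Fin r → Fin s) → (∀ k → toℕ (g k) ≡ i ℕ.+ toℕ k) →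
                   i ℕ.+ r ≤ s → tabulate (f ∘ g) ≡ take r (drop i (tabulate f))
  tabulate-shift {r = zero}  f i g g-shift _    = refl
  tabulate-shift {r = suc r} f i g g-shift i+r≤ = begin
    f (g Fin.zero) ∷ tabulate (f ∘ g ∘ Fin.suc)           ≡⟨ cong₂ _∷_ (cong f head≡) (tabulate-shift f (suc i) (g ∘ Fin.suc)
                                                               (λ k → trans (g-shift (Fin.suc k)) (ℕ.+-suc i (toℕ k))) i+1+r≤) ⟩
    f (fromℕ< i<s) ∷ take r (drop (suc i) (tabulate f))   ≡⟨ cong (take (suc r)) (drop-tabulate f i i<s) ⟨
    take (suc r) (drop i (tabulate f))                     ∎
    where
    i+1+r≤ : suc i ℕ.+ r ≤ _
    i+1+r≤ = ℕ.≤-trans (ℕ.≤-reflexive (sym (ℕ.+-suc i r))) i+r≤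
    i<s : i < _
    i<s = ℕ.≤-trans (s≤s (ℕ.m≤m+n i r)) i+1+r≤
    head≡ : g Fin.zero ≡ fromℕ< i<s
    head≡ = toℕ-injective (trans (g-shift Fin.zero) (trans (ℕ.+-identityʳ i) (sym (toℕ-fromℕ< i<s))))

  window-unimodular : ∀ {s r} (M : Matrix s r) → UnimodularWindows r (tabulate M) →
                      (i : ℕ) (h : i ℕ.+ r ≤ s) → Unimodular (window M i h)
  window-unimodular M windows i h =
    subst IsUnit (sym (trans (det≡detRows (window M i h))
                             (cong detRows (tabulate-shift M i _ (λ k → toℕ-fromℕ< _) h))))
      (windows i (subst (i ℕ.+ _ ≤_) (sym (List.length-tabulate M)) h))

  I≗basis : ∀ r (a : Fin r) → I r a ≗ basis a
  I≗basis r a b with a Fin.≟ b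
  ... | yes refl = sym (basis-diag a)
  ... | no  a≢b  = sym (basis-≢ a≢b)

  tabulate-stack : ∀ {r} (B : Matrix r r) (X Y : List (Row r)) →
                   tabulate (I r ⊘ List.lookup X ⊘ B ⊘ List.lookup Y ⊘ I r) ≋
                   identityRows r ++ X ++ tabulate B ++ Y ++ identityRows r
  tabulate-stack {r} B X Y = subst (_≋ identityRows r ++ X ++ tabulate B ++ Y ++ identityRows r) (sym split)
    (Pointwise.++⁺ tabulate-I (Pointwise.++⁺ (lookup≋ X)
      (Pointwise.++⁺ (≋-refl {xs = tabulate B}) (Pointwise.++⁺ (lookup≋ Y) tabulate-I))))
    where
    tabulate-I : tabulate (I r) ≋ identityRows r
    tabulate-I = Pointwise.tabulate⁺ (I≗basis r)
    lookup≋ : ∀ Z → tabulate (List.lookup Z) ≋ Z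
    lookup≋ Z = subst (tabulate (List.lookup Z) ≋_) (List.tabulate-lookup Z) ≋-refl
    split : tabulate (I r ⊘ List.lookup X ⊘ B ⊘ List.lookup Y ⊘ I r) ≡
            tabulate (I r) ++ tabulate (List.lookup X) ++ tabulate B ++ tabulate (List.lookup Y) ++ tabulate (I r)
    split = begin
      tabulate (I r ⊘ List.lookup X ⊘ B ⊘ List.lookup Y ⊘ I r)
        ≡⟨ tabulate-⊘ (I r) _ ⟩
      tabulate (I r) ++ tabulate (List.lookup X ⊘ B ⊘ List.lookup Y ⊘ I r)
        ≡⟨ cong (tabulate (I r) ++_) (tabulate-⊘ (List.lookup X) _) ⟩
      tabulate (I r) ++ tabulate (List.lookup X) ++ tabulate (B ⊘ List.lookup Y ⊘ I r)
        ≡⟨ cong (λ L → tabulate (I r) ++ tabulate (List.lookup X) ++ L) (tabulate-⊘ B _) ⟩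
      tabulate (I r) ++ tabulate (List.lookup X) ++ tabulate B ++ tabulate (List.lookup Y ⊘ I r)
        ≡⟨ cong (λ L → tabulate (I r) ++ tabulate (List.lookup X) ++ tabulate B ++ L) (tabulate-⊘ (List.lookup Y) (I r)) ⟩
      tabulate (I r) ++ tabulate (List.lookup X) ++ tabulate B ++ tabulate (List.lookup Y) ++ tabulate (I r) ∎

open RowReduction
  using (IsUnit; det≡detRows; unimodular-bridge; window-unimodular; UnimodularWindows-cong; tabulate-stack)
open import Data.Nat using (ℕ; zero; suc; _+_; _≤_; _>_; s≤s; z≤n)
open import Data.Product using (Σ; _×_; ∃-syntax; _,_)
open import Data.List using (length; lookup; tabulate)
open import Data.Sum using (inj₁)
open import Relation.Binary.PropositionalEquality using (refl; subst)

lemma4p15 : (r : ℕ) (B : Matrix r r) → Unimodular B →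
    ∃[ p ] ∃[ q ] Σ (Matrix p r) λ S → Σ (Matrix q r) λ T →
    (r + (p + (r + (q + r))) > 0) ×
    ((i : ℕ) (h : i + r ≤ r + (p + (r + (q + r)))) →
    Unimodular (window (I r ⊘ S ⊘ B ⊘ T ⊘ I r) i h))
lemma4p15 zero    B u = 1 , 0 , (λ _ ()) , (λ ()) , s≤s z≤n , λ _ _ → inj₁ refl
lemma4p15 (suc r) B u =
  let X , Y , windows = unimodular-bridge (tabulate B) (subst IsUnit (det≡detRows B) u)
  in length X , length Y , lookup X , lookup Y , s≤s z≤n ,
     window-unimodular (I (suc r) ⊘ lookup X ⊘ B ⊘ lookup Y ⊘ I (suc r))
       (UnimodularWindows-cong (tabulate-stack B X Y) windows)
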